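{- Let $n,r$ be positive integers and $m_1,\dots,m_r$ positive integers with $\sum_{i=1}^r m_i=m\leq 2^n$. Then $\sum_{i=1}^{r}ex_{m_i}\leq ex_{m-r+1}$.
   Context: The $n$-dimensional hypercube $Q_n$ has as vertices all binary strings of length $n$, two vertices being adjacent iff they differ in exactly one coordinate. For $1\le k\le 2^n$, $ex_k=ex_k(Q_n)=\max\{2|E(Q_n[X])| : X\subseteq V(Q_n),\ |X|=k\}$, the maximum degree sum of a subgraph of $Q_n$ induced by $k$ vertices. -}

module Defs where

open import Data.Bool using (Bool; true; false; if_then_else_)
open import Data.Nat using (ℕ; zero; suc; _+_; _⊔_; _≟_)
open import Data.Vec using (Vec; []; _∷_)
open import Data.List using (List; []; _∷_; [_]; map; _++_; length; filter; foldr)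
open import Data.Nat.ListAction using (sum)
open import Relation.Nullary using (Dec)
open import Relation.Binary.PropositionalEquality using (_≡_)
open import Relation.Nullary.Decidable using (⌊_⌋)

Vertex : ℕ → Set
Vertex n = Vec Bool n

hamming : ∀ {n} → Vertex n → Vertex n → ℕ
hamming []       []       = 0
hamming (a ∷ u) (b ∷ v) = (if ⌊ a Data.Bool.≟ b ⌋ then 0 else 1) + hamming u v

adj? : ∀ {n} (u v : Vertex n) → Dec (hamming u v ≡ 1)
adj? u v = hamming u v ≟ 1

vertices : (n : ℕ) → List (Vertex n)
vertices zero    = [ [] ]
vertices (suc n) = map (false ∷_) (vertices n) ++ map (true ∷_) (vertices n)

-- All sublists of a list (2^length many); sublists of a duplicate-free list
-- are exactly its subsets.
sublists : ∀ {A : Set} → List A → List (List A)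
sublists []       = [ [] ]
sublists (x ∷ xs) = map (x ∷_) (sublists xs) ++ sublists xs

-- Degree sum of the induced subgraph Q_n[X] = number of ordered adjacent
-- pairs (u , v) with u , v ∈ X  = 2 |E(Q_n[X])|.
degSum : ∀ {n} → List (Vertex n) → ℕ
degSum X = sum (map (λ u → length (filter (adj? u) X)) X)

subsetsOfSize : (n k : ℕ) → List (List (Vertex n))
subsetsOfSize n k = filter (λ X → length X ≟ k) (sublists (vertices n))

ex : (n k : ℕ) → ℕ
ex n k = foldr _⊔_ 0 (map degSum (subsetsOfSize n k))

module Submission where

-- Let h₀ = 0 and hₙ₊₁(k) = hₙ(⌈k/2⌉) + hₙ(⌊k/2⌋) + 2⌊k/2⌋ (the function harper below). Splitting
-- Q_{n+1} along its first coordinate into two copies of Q_n, a k-set X of vertices becomes two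
-- sets A, B in Q_n, joined by a matching of some size c ≤ min(|A|, |B|). Hence ex_k ≤ hₙ(k) follows
-- by induction from hₙ(a) + hₙ(b) + 2c ≤ hₙ₊₁(a + b) for c ≤ min(a, b), which is itself proved by
-- induction on n by pairing ⌈a/2⌉ with ⌊b/2⌋ and ⌊a/2⌋ with ⌈b/2⌉. Initial segments of the binary
-- order attain hₙ(k), so ex_k = hₙ(k) for k ≤ 2ⁿ (Harper). The theorem then reduces to
-- h(a + 1) + h(b + 1) ≤ h(a + b + 1): for a ≤ b, bound h(a + 1) ≤ h(a) + 2a and apply the
-- inequality above with c = a; summing over the mᵢ gives Σ h(mᵢ) ≤ h(m − r + 1).

open import Defs
open import Data.Nat using (ℕ; zero; suc; pred; _+_; _*_; _∸_; _^_; _≤_; _<_; z≤n; s≤s; ⌊_/2⌋; ⌈_/2⌉)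
open import Data.Nat.Properties
open import Data.Nat.Tactic.RingSolver using (solve-∀)
open import Algebra.Properties.CommutativeSemigroup +-commutativeSemigroup using (interchange; x∙yz≈y∙xz; xy∙z≈xz∙y)
open import Data.Product using (_×_; _,_)
import Data.Product as Product
open import Data.Sum using (_⊎_; inj₁; inj₂)
import Data.Sum as Sum
open import Function using (_∘_; flip)
open import Relation.Binary.PropositionalEquality using (_≡_; _≢_; refl; sym; trans; cong; cong₂; subst; subst₂; module ≡-Reasoning)

-- The dimension n acts as fuel: harper n k is meaningful only for k ≤ 2ⁿ (see harper-stable).
harper : ℕ → ℕ → ℕ
harper zero    k = 0
harper (suc n) k = harper n ⌈ k /2⌉ + harper n ⌊ k /2⌋ + 2 * ⌊ k /2⌋

halves-+ : ∀ a b →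
  (⌈ a + b /2⌉ ≡ ⌈ a /2⌉ + ⌊ b /2⌋ × ⌊ a + b /2⌋ ≡ ⌊ a /2⌋ + ⌈ b /2⌉) ⊎
  (⌈ a + b /2⌉ ≡ ⌊ a /2⌋ + ⌈ b /2⌉ × ⌊ a + b /2⌋ ≡ ⌈ a /2⌉ + ⌊ b /2⌋)
halves-+ zero          b = inj₂ (refl , refl)
halves-+ (suc zero)    b = inj₁ (refl , refl)
halves-+ (suc (suc a)) b =
  Sum.map (Product.map (cong suc) (cong suc)) (Product.map (cong suc) (cong suc)) (halves-+ a b)

⌊m/2⌋+⌊n/2⌋≤⌊m+n/2⌋ : ∀ a b → ⌊ a /2⌋ + ⌊ b /2⌋ ≤ ⌊ a + b /2⌋
⌊m/2⌋+⌊n/2⌋≤⌊m+n/2⌋ a b with halves-+ a b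
... | inj₁ (_ , eq) = ≤-trans (+-monoʳ-≤ ⌊ a /2⌋ (⌊n/2⌋≤⌈n/2⌉ b)) (≤-reflexive (sym eq))
... | inj₂ (_ , eq) = ≤-trans (+-monoˡ-≤ ⌊ b /2⌋ (⌊n/2⌋≤⌈n/2⌉ a)) (≤-reflexive (sym eq))

o≤m⇒o≤n⇒o≤⌊m+n/2⌋ : ∀ {a b c} → c ≤ a → c ≤ b → c ≤ ⌊ a + b /2⌋
o≤m⇒o≤n⇒o≤⌊m+n/2⌋ {c = c} c≤a c≤b = subst (_≤ _) (sym (n≡⌊n+n/2⌋ c)) (⌊n/2⌋-mono (+-mono-≤ c≤a c≤b))

⌈k/2⌉≤2^n : ∀ n {k} → k ≤ 2 ^ suc n → ⌈ k /2⌉ ≤ 2 ^ n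
⌈k/2⌉≤2^n n {k} k≤ = subst (⌈ k /2⌉ ≤_) (sym (n≡⌈n+n/2⌉ (2 ^ n)))
  (⌈n/2⌉-mono (subst (k ≤_) (cong (2 ^ n +_) (+-identityʳ (2 ^ n))) k≤))

⌊k/2⌋≤2^n : ∀ n {k} → k ≤ 2 ^ suc n → ⌊ k /2⌋ ≤ 2 ^ n
⌊k/2⌋≤2^n n {k} k≤ = ≤-trans (⌊n/2⌋≤⌈n/2⌉ k) (⌈k/2⌉≤2^n n k≤)

harper-cross-halves : ∀ m a b → harper (suc m) (a + b) ≡
  harper m (⌈ a /2⌉ + ⌊ b /2⌋) + harper m (⌊ a /2⌋ + ⌈ b /2⌉) + 2 * ⌊ a + b /2⌋
harper-cross-halves m a b with halves-+ a b
... | inj₁ (eq₁ , eq₀) = cong₂ (λ x y → harper m x + harper m y + 2 * ⌊ a + b /2⌋) eq₁ eq₀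
... | inj₂ (eq₁ , eq₀) = trans (cong₂ (λ x y → harper m x + harper m y + 2 * ⌊ a + b /2⌋) eq₁ eq₀)
                               (cong (_+ 2 * ⌊ a + b /2⌋) (+-comm (harper m (⌊ a /2⌋ + ⌈ b /2⌉)) (harper m (⌈ a /2⌉ + ⌊ b /2⌋))))

harper-double : ∀ m a → harper (suc m) (a + a) ≡ harper m a + harper m a + 2 * a
harper-double m a = sym (cong₂ (λ x y → harper m x + harper m y + 2 * y) (n≡⌈n+n/2⌉ a) (n≡⌊n+n/2⌋ a))

Superadditive : ℕ → Set
Superadditive n = ∀ {a b c} → c ≤ a → c ≤ b → harper n a + harper n b + 2 * c ≤ harper (suc n) (a + b)

-- ⌈a/2⌉ + ⌊b/2⌋ and ⌊a/2⌋ + ⌈b/2⌉ are the two halves of a + b; c is split as ⌊c/2⌋ + ⌈c/2⌉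
-- between the two pairs, and ⌈c/2⌉ ≤ ⌊a/2⌋ is where c < a is needed.
harper-superadditive-step : ∀ {n} → Superadditive n → ∀ {a b c} → c < a → c ≤ b →
  harper (suc n) a + harper (suc n) b + 2 * c ≤ harper (suc (suc n)) (a + b)
harper-superadditive-step {n} ih {a} {b} {c} c<a c≤b = begin
  harper (suc n) a + harper (suc n) b + 2 * c
    ≡⟨ cong (λ x → harper (suc n) a + harper (suc n) b + 2 * x) (sym (⌊n/2⌋+⌈n/2⌉≡n c)) ⟩
  harper n a₁ + harper n a₀ + 2 * a₀ + (harper n b₁ + harper n b₀ + 2 * b₀) + 2 * (c₀ + c₁)
    ≡⟨ regroup (harper n a₁) (harper n a₀) a₀ (harper n b₁) (harper n b₀) b₀ c₀ c₁ ⟩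
  (harper n a₁ + harper n b₀ + 2 * c₀) + (harper n a₀ + harper n b₁ + 2 * c₁) + 2 * (a₀ + b₀)
    ≤⟨ +-mono-≤ (+-mono-≤ (ih c₀≤a₁ c₀≤b₀) (ih c₁≤a₀ c₁≤b₁)) (*-monoʳ-≤ 2 (⌊m/2⌋+⌊n/2⌋≤⌊m+n/2⌋ a b)) ⟩
  harper (suc n) (a₁ + b₀) + harper (suc n) (a₀ + b₁) + 2 * ⌊ a + b /2⌋
    ≡⟨ harper-cross-halves (suc n) a b ⟨
  harper (suc (suc n)) (a + b) ∎
  where
  open ≤-Reasoning
  a₁ = ⌈ a /2⌉; a₀ = ⌊ a /2⌋; b₁ = ⌈ b /2⌉; b₀ = ⌊ b /2⌋; c₁ = ⌈ c /2⌉; c₀ = ⌊ c /2⌋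
  c₀≤a₁ : c₀ ≤ a₁
  c₀≤a₁ = ≤-trans (⌊n/2⌋-mono (<⇒≤ c<a)) (⌊n/2⌋≤⌈n/2⌉ a)
  c₀≤b₀ : c₀ ≤ b₀
  c₀≤b₀ = ⌊n/2⌋-mono c≤b
  c₁≤a₀ : c₁ ≤ a₀
  c₁≤a₀ = ⌊n/2⌋-mono c<a
  c₁≤b₁ : c₁ ≤ b₁
  c₁≤b₁ = ⌈n/2⌉-mono c≤b
  regroup : ∀ x₁ x₀ a₀ y₁ y₀ b₀ c₀ c₁ →
    x₁ + x₀ + 2 * a₀ + (y₁ + y₀ + 2 * b₀) + 2 * (c₀ + c₁) ≡
    (x₁ + y₀ + 2 * c₀) + (x₀ + y₁ + 2 * c₁) + 2 * (a₀ + b₀)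
  regroup = solve-∀

harper-superadditive : ∀ n → Superadditive n
harper-superadditive zero    c≤a c≤b = *-monoʳ-≤ 2 (o≤m⇒o≤n⇒o≤⌊m+n/2⌋ c≤a c≤b)
harper-superadditive (suc n) {a} {b} {c} c≤a c≤b with m≤n⇒m<n∨m≡n c≤a | m≤n⇒m<n∨m≡n c≤b
... | inj₁ c<a  | _         = harper-superadditive-step {n} (harper-superadditive n) c<a c≤b
... | inj₂ refl | inj₁ c<b  = subst₂ _≤_ (cong (_+ 2 * c) (+-comm (harper (suc n) b) (harper (suc n) c)))
                                          (cong (harper (suc (suc n))) (+-comm b c))
                                          (harper-superadditive-step {n} (harper-superadditive n) c<b c≤a)
... | inj₂ refl | inj₂ refl = ≤-reflexive (sym (harper-double (suc n) c))

harper-stable : ∀ n {k} → k ≤ 2 ^ n → harper (suc n) k ≡ harper n k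
harper-stable zero    {zero}        _   = refl
harper-stable zero    {suc zero}    _   = refl
harper-stable zero    {suc (suc k)} (s≤s ())
harper-stable (suc n) {k}           k≤ = cong₂ (λ x y → x + y + 2 * ⌊ k /2⌋)
  (harper-stable n (⌈k/2⌉≤2^n n k≤)) (harper-stable n (⌊k/2⌋≤2^n n k≤))

harper-superadditive-≤2^n : ∀ n {a b c} → a + b ≤ 2 ^ n → c ≤ a → c ≤ b →
  harper n a + harper n b + 2 * c ≤ harper n (a + b)
harper-superadditive-≤2^n n a+b≤ c≤a c≤b =
  ≤-trans (harper-superadditive n c≤a c≤b) (≤-reflexive (harper-stable n a+b≤))

harper-suc-≤ : ∀ n t → harper n (suc t) ≤ harper n t + 2 * t
harper-suc-≤ zero    t = z≤n
harper-suc-≤ (suc n) t = begin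
  harper n (suc ⌊ t /2⌋) + harper n ⌈ t /2⌉ + 2 * ⌈ t /2⌉
    ≤⟨ +-monoˡ-≤ (2 * ⌈ t /2⌉) (+-monoˡ-≤ (harper n ⌈ t /2⌉) (harper-suc-≤ n ⌊ t /2⌋)) ⟩
  harper n ⌊ t /2⌋ + 2 * ⌊ t /2⌋ + harper n ⌈ t /2⌉ + 2 * ⌈ t /2⌉
    ≡⟨ regroup (harper n ⌊ t /2⌋) ⌊ t /2⌋ (harper n ⌈ t /2⌉) ⌈ t /2⌉ ⟩
  harper (suc n) t + 2 * ⌈ t /2⌉
    ≤⟨ +-monoʳ-≤ (harper (suc n) t) (*-monoʳ-≤ 2 (⌈n/2⌉≤n t)) ⟩
  harper (suc n) t + 2 * t ∎
  where
  open ≤-Reasoning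
  regroup : ∀ x₀ t₀ x₁ t₁ → x₀ + 2 * t₀ + x₁ + 2 * t₁ ≡ x₁ + x₀ + 2 * t₀ + 2 * t₁
  regroup = solve-∀

harper-suc-superadditive-ordered : ∀ n {a b} → a ≤ b → suc (a + b) ≤ 2 ^ n →
  harper n (suc a) + harper n (suc b) ≤ harper n (suc (a + b))
harper-suc-superadditive-ordered n {a} {b} a≤b bound = begin
  harper n (suc a) + harper n (suc b)   ≤⟨ +-monoˡ-≤ (harper n (suc b)) (harper-suc-≤ n a) ⟩
  harper n a + 2 * a + harper n (suc b) ≡⟨ xy∙z≈xz∙y (harper n a) (2 * a) (harper n (suc b)) ⟩
  harper n a + harper n (suc b) + 2 * a ≤⟨ harper-superadditive-≤2^n n bound′ ≤-refl (m≤n⇒m≤1+n a≤b) ⟩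
  harper n (a + suc b)                  ≡⟨ cong (harper n) (+-suc a b) ⟩
  harper n (suc (a + b))                ∎
  where
  open ≤-Reasoning
  bound′ : a + suc b ≤ 2 ^ n
  bound′ = subst (_≤ 2 ^ n) (sym (+-suc a b)) bound

harper-suc-superadditive : ∀ n {a b} → suc (a + b) ≤ 2 ^ n →
  harper n (suc a) + harper n (suc b) ≤ harper n (suc (a + b))
harper-suc-superadditive n {a} {b} bound with ≤-total a b
... | inj₁ a≤b = harper-suc-superadditive-ordered n a≤b bound
... | inj₂ b≤a = subst₂ _≤_ (+-comm (harper n (suc b)) (harper n (suc a))) (cong (harper n ∘ suc) (+-comm b a))
                   (harper-suc-superadditive-ordered n b≤a (subst (λ x → suc x ≤ 2 ^ n) (+-comm a b) bound))

module Hypercube where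

  open import Data.Bool using (Bool; true; false)
  import Data.Bool as Bool
  open import Data.Nat using (_⊔_; _≟_)
  open import Data.Product using (∃; ∃₂)
  open import Relation.Binary.Definitions using (DecidableEquality)
  open import Relation.Nullary using (Dec; does)
  open import Relation.Unary using (Decidable)
  open import Data.List using (List; []; _∷_; [_]; map; _++_; length; filter; foldr)
  open import Data.List.Properties using (length-++; length-map; map-++; map-∘; map-cong; filter-++; filter-≐; filter-none; filter-some; foldr-preservesᵇ)
  open import Data.Nat.ListAction using (sum)
  open import Data.Nat.ListAction.Properties using (sum-++)
  import Data.List.Relation.Unary.All as All
  import Data.List.Relation.Unary.All.Properties as All
  open import Data.List.Relation.Unary.Any using (here; there)
  open import Data.List.Membership.Propositional using (_∈_)
  open import Data.List.Membership.Propositional.Properties using (∈-++⁺ˡ; ∈-++⁺ʳ; ∈-++⁻; ∈-map⁺; ∈-map⁻; ∈-filter⁺; ∈-filter⁻)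
  open import Data.List.Relation.Binary.Sublist.Propositional using (_⊆_; []; _∷_; _∷ʳ_; minimum; ⊆-refl)
  open import Data.List.Relation.Binary.Sublist.Propositional.Properties using (map⁺; ++⁺; filter⁺; length-mono-≤)
  open import Data.Vec using ([]; _∷_)
  open import Data.Vec.Properties using (≡-dec; ∷-injectiveˡ; ∷-injectiveʳ)

  private variable
    A B C : Set

  length-filter-map : ∀ {P : B → Set} (P? : Decidable P) (g : A → B) xs →
    length (filter P? (map g xs)) ≡ length (filter (P? ∘ g) xs)
  length-filter-map P? g []       = refl
  length-filter-map P? g (x ∷ xs) with does (P? (g x))
  ... | true  = cong suc (length-filter-map P? g xs)
  ... | false = length-filter-map P? g xs

  length-filter-++ : ∀ {P : A → Set} (P? : Decidable P) xs ys →
    length (filter P? (xs ++ ys)) ≡ length (filter P? xs) + length (filter P? ys)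
  length-filter-++ P? xs ys = trans (cong length (filter-++ P? xs ys)) (length-++ (filter P? xs))

  length-blocks : ∀ (f g : C → A) X Y → length (map f X ++ map g Y) ≡ length X + length Y
  length-blocks f g X Y = trans (length-++ (map f X)) (cong₂ _+_ (length-map f X) (length-map g Y))

  pairCount : ∀ {R : A → B → Set} → (∀ u v → Dec (R u v)) → List A → List B → ℕ
  pairCount R? X Y = sum (map (λ u → length (filter (R? u) Y)) X)

  module _ {R : A → B → Set} (R? : ∀ u v → Dec (R u v)) where

    pairCount-++ˡ : ∀ X X′ Y → pairCount R? (X ++ X′) Y ≡ pairCount R? X Y + pairCount R? X′ Y
    pairCount-++ˡ X X′ Y = trans (cong sum (map-++ _ X X′)) (sum-++ (map _ X) (map _ X′))

    pairCount-++ʳ : ∀ X Y Y′ → pairCount R? X (Y ++ Y′) ≡ pairCount R? X Y + pairCount R? X Y′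
    pairCount-++ʳ []      Y Y′ = refl
    pairCount-++ʳ (u ∷ X) Y Y′ = begin
      length (filter (R? u) (Y ++ Y′)) + pairCount R? X (Y ++ Y′)
        ≡⟨ cong₂ _+_ (length-filter-++ (R? u) Y Y′) (pairCount-++ʳ X Y Y′) ⟩
      length (filter (R? u) Y) + length (filter (R? u) Y′) + (pairCount R? X Y + pairCount R? X Y′)
        ≡⟨ interchange (length (filter (R? u) Y)) (length (filter (R? u) Y′)) (pairCount R? X Y) (pairCount R? X Y′) ⟩
      pairCount R? (u ∷ X) Y + pairCount R? (u ∷ X) Y′ ∎
      where open ≡-Reasoning

    pairCount-mapˡ : ∀ (f : C → A) X Y → pairCount R? (map f X) Y ≡ pairCount (R? ∘ f) X Y
    pairCount-mapˡ f X Y = cong sum (sym (map-∘ X))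

    pairCount-mapʳ : ∀ (g : C → B) X Y → pairCount R? X (map g Y) ≡ pairCount (λ u → R? u ∘ g) X Y
    pairCount-mapʳ g X Y = cong sum (map-cong (λ u → length-filter-map (R? u) g Y) X)

    pairCount-[-]ʳ : ∀ X v → pairCount R? X [ v ] ≡ length (filter (λ u → R? u v) X)
    pairCount-[-]ʳ []      v = refl
    pairCount-[-]ʳ (u ∷ X) v with does (R? u v)
    ... | true  = cong suc (pairCount-[-]ʳ X v)
    ... | false = pairCount-[-]ʳ X v

    pairCount-∷ʳ : ∀ X v Y → pairCount R? X (v ∷ Y) ≡ length (filter (λ u → R? u v) X) + pairCount R? X Y
    pairCount-∷ʳ X v Y = trans (pairCount-++ʳ X [ v ] Y) (cong (_+ pairCount R? X Y) (pairCount-[-]ʳ X v))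

    pairCount-[]ʳ : ∀ X → pairCount R? X [] ≡ 0
    pairCount-[]ʳ []      = refl
    pairCount-[]ʳ (u ∷ X) = pairCount-[]ʳ X

    pairCount-flip : ∀ X Y → pairCount R? X Y ≡ pairCount (flip R?) Y X
    pairCount-flip X []      = pairCount-[]ʳ X
    pairCount-flip X (v ∷ Y) = trans (pairCount-∷ʳ X v Y) (cong (length (filter (λ u → R? u v) X) +_) (pairCount-flip X Y))

    pairCount-≤-∷ʳ : ∀ X v Y → pairCount R? X Y ≤ pairCount R? X (v ∷ Y)
    pairCount-≤-∷ʳ X v Y = ≤-trans (m≤n+m _ _) (≤-reflexive (sym (pairCount-∷ʳ X v Y)))

    pairCount-≤-length : ∀ X Y → (∀ u → length (filter (R? u) Y) ≤ 1) → pairCount R? X Y ≤ length X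
    pairCount-≤-length []      Y once = z≤n
    pairCount-≤-length (u ∷ X) Y once = +-mono-≤ (once u) (pairCount-≤-length X Y once)

  pairCount-≐ : ∀ {R S : A → B → Set} (R? : ∀ u v → Dec (R u v)) (S? : ∀ u v → Dec (S u v)) →
    (∀ {u v} → R u v → S u v) → (∀ {u v} → S u v → R u v) → ∀ X Y → pairCount R? X Y ≡ pairCount S? X Y
  pairCount-≐ R? S? R⇒S S⇒R X Y = cong sum (map-cong (λ u → cong length (filter-≐ (R? u) (S? u) (R⇒S , S⇒R) Y)) X)

  pairCount-blocks : ∀ {R : A → A → Set} (R? : ∀ u v → Dec (R u v)) (f g : C → A) (X Y X′ Y′ : List C) →
    pairCount R? (map f X ++ map g Y) (map f X′ ++ map g Y′) ≡
    (pairCount (λ u v → R? (f u) (f v)) X X′ + pairCount (λ u v → R? (f u) (g v)) X Y′) +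
    (pairCount (λ u v → R? (g u) (f v)) Y X′ + pairCount (λ u v → R? (g u) (g v)) Y Y′)
  pairCount-blocks R? f g X Y X′ Y′ = begin
    pairCount R? (map f X ++ map g Y) Z
      ≡⟨ pairCount-++ˡ R? (map f X) (map g Y) Z ⟩
    pairCount R? (map f X) Z + pairCount R? (map g Y) Z
      ≡⟨ cong₂ _+_ (pairCount-mapˡ R? f X Z) (pairCount-mapˡ R? g Y Z) ⟩
    pairCount (R? ∘ f) X Z + pairCount (R? ∘ g) Y Z
      ≡⟨ cong₂ _+_ (pairCount-++ʳ (R? ∘ f) X (map f X′) (map g Y′)) (pairCount-++ʳ (R? ∘ g) Y (map f X′) (map g Y′)) ⟩
    (pairCount (R? ∘ f) X (map f X′) + pairCount (R? ∘ f) X (map g Y′)) +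
    (pairCount (R? ∘ g) Y (map f X′) + pairCount (R? ∘ g) Y (map g Y′))
      ≡⟨ cong₂ _+_ (cong₂ _+_ (pairCount-mapʳ (R? ∘ f) f X X′) (pairCount-mapʳ (R? ∘ f) g X Y′))
                   (cong₂ _+_ (pairCount-mapʳ (R? ∘ g) f Y X′) (pairCount-mapʳ (R? ∘ g) g Y Y′)) ⟩
    _ ∎
    where
    open ≡-Reasoning
    Z = map f X′ ++ map g Y′

  pairCount-≡-sym : (_≟_ : DecidableEquality A) (X Y : List A) → pairCount _≟_ X Y ≡ pairCount _≟_ Y X
  pairCount-≡-sym _≟_ X Y = trans (pairCount-flip _≟_ X Y) (pairCount-≐ (flip _≟_) _≟_ sym sym Y X)

  ⊆⇒length≤pairCount : (_≟_ : DecidableEquality A) {X Y : List A} → X ⊆ Y → length X ≤ pairCount _≟_ X Y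
  ⊆⇒length≤pairCount _≟_ []                          = z≤n
  ⊆⇒length≤pairCount _≟_ (_∷ʳ_ {xs = X} {ys = Y} y X⊆Y) =
    ≤-trans (⊆⇒length≤pairCount _≟_ X⊆Y) (pairCount-≤-∷ʳ _≟_ X y Y)
  ⊆⇒length≤pairCount _≟_ (_∷_ {x = x} {xs = X} {ys = Y} refl X⊆Y) = +-mono-≤
    (filter-some (x ≟_) (here refl))
    (≤-trans (⊆⇒length≤pairCount _≟_ X⊆Y) (pairCount-≤-∷ʳ _≟_ X x Y))

  ∈-sublists⁺ : ∀ {X L : List A} → X ⊆ L → X ∈ sublists L
  ∈-sublists⁺ []                           = here refl
  ∈-sublists⁺ (_∷ʳ_ {ys = L} y X⊆L)       = ∈-++⁺ʳ (map (y ∷_) (sublists L)) (∈-sublists⁺ X⊆L)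
  ∈-sublists⁺ (_∷_ {x = x} refl X⊆L)      = ∈-++⁺ˡ (∈-map⁺ (x ∷_) (∈-sublists⁺ X⊆L))

  ∈-sublists⁻ : ∀ (L : List A) {X} → X ∈ sublists L → X ⊆ L
  ∈-sublists⁻ []      (here refl) = []
  ∈-sublists⁻ (x ∷ L) X∈ with ∈-++⁻ (map (x ∷_) (sublists L)) X∈
  ... | inj₂ X∈′ = x ∷ʳ ∈-sublists⁻ L X∈′
  ... | inj₁ X∈ₓ with ∈-map⁻ (x ∷_) X∈ₓ
  ...   | _ , Y∈ , refl = refl ∷ ∈-sublists⁻ L Y∈

  ⊆-++-inv : ∀ (L : List A) {L′ X} → X ⊆ L ++ L′ → ∃₂ λ X₁ X₂ → X ≡ X₁ ++ X₂ × X₁ ⊆ L × X₂ ⊆ L′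
  ⊆-++-inv []      X⊆ = [] , _ , refl , [] , X⊆
  ⊆-++-inv (x ∷ L) (.x ∷ʳ X⊆) with ⊆-++-inv L X⊆
  ... | X₁ , X₂ , refl , X₁⊆ , X₂⊆ = X₁ , X₂ , refl , x ∷ʳ X₁⊆ , X₂⊆
  ⊆-++-inv (x ∷ L) (refl ∷ X⊆) with ⊆-++-inv L X⊆
  ... | X₁ , X₂ , refl , X₁⊆ , X₂⊆ = x ∷ X₁ , X₂ , refl , refl ∷ X₁⊆ , X₂⊆

  ⊆-map-inv : ∀ (f : B → A) L {X} → X ⊆ map f L → ∃ λ X′ → X ≡ map f X′ × X′ ⊆ L
  ⊆-map-inv f []      []          = [] , refl , []
  ⊆-map-inv f (x ∷ L) (._ ∷ʳ X⊆) with ⊆-map-inv f L X⊆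
  ... | X′ , refl , X′⊆ = X′ , refl , x ∷ʳ X′⊆
  ⊆-map-inv f (x ∷ L) (refl ∷ X⊆) with ⊆-map-inv f L X⊆
  ... | X′ , refl , X′⊆ = x ∷ X′ , refl , refl ∷ X′⊆

  _≟ᵥ_ : ∀ {n} → DecidableEquality (Vertex n)
  _≟ᵥ_ = ≡-dec Bool._≟_

  hamming≡0⇒≡ : ∀ {n} {u v : Vertex n} → hamming u v ≡ 0 → u ≡ v
  hamming≡0⇒≡ {u = []}        {[]}        _  = refl
  hamming≡0⇒≡ {u = true ∷ u}  {true ∷ v}  eq = cong (true ∷_) (hamming≡0⇒≡ eq)
  hamming≡0⇒≡ {u = false ∷ u} {false ∷ v} eq = cong (false ∷_) (hamming≡0⇒≡ eq)

  hamming-self : ∀ {n} (u : Vertex n) → hamming u u ≡ 0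
  hamming-self []          = refl
  hamming-self (true ∷ u)  = hamming-self u
  hamming-self (false ∷ u) = hamming-self u

  pairCount-adj-across : ∀ {n} (X Y : List (Vertex n)) →
    pairCount (λ u v → adj? (false ∷ u) (true ∷ v)) X Y ≡ pairCount _≟ᵥ_ X Y
  pairCount-adj-across = pairCount-≐ _ _≟ᵥ_ (hamming≡0⇒≡ ∘ suc-injective) λ { {u} refl → cong suc (hamming-self u) }

  -- degSum X is pairCount adj? X X by definition, and adj? (true ∷ u) (false ∷ v) reduces to the
  -- same decider as adj? (false ∷ u) (true ∷ v), so pairCount-adj-across serves both cross terms.
  degSum-split : ∀ {n} (X Y : List (Vertex n)) →
    degSum (map (false ∷_) X ++ map (true ∷_) Y) ≡ degSum X + degSum Y + 2 * pairCount _≟ᵥ_ X Y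
  degSum-split X Y = begin
    degSum (map (false ∷_) X ++ map (true ∷_) Y)
      ≡⟨ pairCount-blocks adj? (false ∷_) (true ∷_) X Y X Y ⟩
    degSum X + pairCount across X Y + (pairCount across Y X + degSum Y)
      ≡⟨ cong₂ (λ p q → degSum X + p + (q + degSum Y))
               (pairCount-adj-across X Y) (trans (pairCount-adj-across Y X) (pairCount-≡-sym _≟ᵥ_ Y X)) ⟩
    degSum X + c + (c + degSum Y)
      ≡⟨ regroup (degSum X) (degSum Y) c ⟩
    degSum X + degSum Y + 2 * c ∎
    where
    open ≡-Reasoning
    across = λ u v → adj? (false ∷ u) (true ∷ v)
    c = pairCount _≟ᵥ_ X Y
    regroup : ∀ a b c → a + c + (c + b) ≡ a + b + 2 * c
    regroup = solve-∀

  module _ {n} (b : Bool) (u : Vertex n) (Y : List (Vertex n)) where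

    count-same-block : length (filter ((b ∷ u) ≟ᵥ_) (map (b ∷_) Y)) ≡ length (filter (u ≟ᵥ_) Y)
    count-same-block = trans (length-filter-map ((b ∷ u) ≟ᵥ_) (b ∷_) Y)
                             (cong length (filter-≐ _ (u ≟ᵥ_) (∷-injectiveʳ , cong (b ∷_)) Y))

    count-other-block : ∀ {b′} → b ≢ b′ → length (filter ((b ∷ u) ≟ᵥ_) (map (b′ ∷_) Y)) ≡ 0
    count-other-block {b′} b≢b′ = trans (length-filter-map ((b ∷ u) ≟ᵥ_) _ Y)
                                   (cong length (filter-none (((b ∷ u) ≟ᵥ_) ∘ (b′ ∷_)) {Y} (All.tabulate λ _ → b≢b′ ∘ ∷-injectiveˡ)))

  vertices-once : ∀ n (u : Vertex n) → length (filter (u ≟ᵥ_) (vertices n)) ≡ 1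
  vertices-once zero    []          = refl
  vertices-once (suc n) (false ∷ u) = trans (length-filter-++ _ (map (false ∷_) (vertices n)) _)
    (cong₂ _+_ (trans (count-same-block false u (vertices n)) (vertices-once n u)) (count-other-block false u (vertices n) λ ()))
  vertices-once (suc n) (true ∷ u)  = trans (length-filter-++ _ (map (false ∷_) (vertices n)) _)
    (cong₂ _+_ (count-other-block true u (vertices n) λ ()) (trans (count-same-block true u (vertices n)) (vertices-once n u)))

  ⊆-vertices-once : ∀ {n} {X : List (Vertex n)} → X ⊆ vertices n → ∀ u → length (filter (u ≟ᵥ_) X) ≤ 1
  ⊆-vertices-once {n} X⊆ u = ≤-trans (length-mono-≤ (filter⁺ (u ≟ᵥ_) (u ≟ᵥ_) (λ a≡b u≡a → trans u≡a a≡b) X⊆))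
                                     (≤-reflexive (vertices-once n u))

  degSum-≤-harper : ∀ n {X : List (Vertex n)} → X ⊆ vertices n → degSum X ≤ harper n (length X)
  degSum-≤-harper zero    ([] ∷ʳ [])  = z≤n
  degSum-≤-harper zero    (refl ∷ []) = z≤n
  degSum-≤-harper (suc n) X⊆ with ⊆-++-inv (map (false ∷_) (vertices n)) X⊆
  ... | X₀ , X₁ , refl , X₀⊆ , X₁⊆ with ⊆-map-inv (false ∷_) (vertices n) X₀⊆ | ⊆-map-inv (true ∷_) (vertices n) X₁⊆
  ... | A , refl , A⊆ | B , refl , B⊆ = begin
    degSum (map (false ∷_) A ++ map (true ∷_) B)
      ≡⟨ degSum-split A B ⟩
    degSum A + degSum B + 2 * c
      ≤⟨ +-monoˡ-≤ (2 * c) (+-mono-≤ (degSum-≤-harper n A⊆) (degSum-≤-harper n B⊆)) ⟩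
    harper n (length A) + harper n (length B) + 2 * c
      ≤⟨ harper-superadditive n c≤A c≤B ⟩
    harper (suc n) (length A + length B)
      ≡⟨ cong (harper (suc n)) (length-blocks (false ∷_) (true ∷_) A B) ⟨
    harper (suc n) (length (map (false ∷_) A ++ map (true ∷_) B)) ∎
    where
    open ≤-Reasoning
    c = pairCount _≟ᵥ_ A B
    c≤A : c ≤ length A
    c≤A = pairCount-≤-length _≟ᵥ_ A B (⊆-vertices-once B⊆)
    c≤B : c ≤ length B
    c≤B = subst (_≤ length B) (pairCount-≡-sym _≟ᵥ_ B A) (pairCount-≤-length _≟ᵥ_ B A (⊆-vertices-once A⊆))

  -- The vertices whose binary value, read with the first coordinate as least significant bit,
  -- is less than k.
  initialSegment : (n k : ℕ) → List (Vertex n)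
  initialSegment zero    zero    = []
  initialSegment zero    (suc k) = [ [] ]
  initialSegment (suc n) k       = map (false ∷_) (initialSegment n ⌈ k /2⌉) ++ map (true ∷_) (initialSegment n ⌊ k /2⌋)

  initialSegment-⊆ : ∀ n k → initialSegment n k ⊆ vertices n
  initialSegment-⊆ zero    zero    = minimum _
  initialSegment-⊆ zero    (suc k) = ⊆-refl
  initialSegment-⊆ (suc n) k       = ++⁺ (map⁺ _ (initialSegment-⊆ n ⌈ k /2⌉)) (map⁺ _ (initialSegment-⊆ n ⌊ k /2⌋))

  initialSegment-mono : ∀ n {j k} → j ≤ k → initialSegment n j ⊆ initialSegment n k
  initialSegment-mono zero    {zero}  {k}     _         = minimum _
  initialSegment-mono zero    {suc j} {suc k} _         = ⊆-refl
  initialSegment-mono (suc n)                 j≤k       =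
    ++⁺ (map⁺ _ (initialSegment-mono n (⌈n/2⌉-mono j≤k))) (map⁺ _ (initialSegment-mono n (⌊n/2⌋-mono j≤k)))

  length-initialSegment : ∀ n {k} → k ≤ 2 ^ n → length (initialSegment n k) ≡ k
  length-initialSegment zero    {zero}        _        = refl
  length-initialSegment zero    {suc zero}    _        = refl
  length-initialSegment zero    {suc (suc k)} (s≤s ())
  length-initialSegment (suc n) {k}           k≤ = begin
    length (map (false ∷_) (initialSegment n ⌈ k /2⌉) ++ map (true ∷_) (initialSegment n ⌊ k /2⌋))
      ≡⟨ length-blocks (false ∷_) (true ∷_) (initialSegment n ⌈ k /2⌉) _ ⟩
    length (initialSegment n ⌈ k /2⌉) + length (initialSegment n ⌊ k /2⌋)
      ≡⟨ cong₂ _+_ (length-initialSegment n (⌈k/2⌉≤2^n n k≤)) (length-initialSegment n (⌊k/2⌋≤2^n n k≤)) ⟩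
    ⌈ k /2⌉ + ⌊ k /2⌋
      ≡⟨ trans (+-comm ⌈ k /2⌉ ⌊ k /2⌋) (⌊n/2⌋+⌈n/2⌉≡n k) ⟩
    k ∎
    where open ≡-Reasoning

  harper-≤-degSum : ∀ n {k} → k ≤ 2 ^ n → harper n k ≤ degSum (initialSegment n k)
  harper-≤-degSum zero    _        = z≤n
  harper-≤-degSum (suc n) {k} k≤ = begin
    harper n ⌈ k /2⌉ + harper n ⌊ k /2⌋ + 2 * ⌊ k /2⌋
      ≤⟨ +-mono-≤ (+-mono-≤ (harper-≤-degSum n k₁≤) (harper-≤-degSum n k₀≤)) (*-monoʳ-≤ 2 k₀≤c) ⟩
    degSum S₁ + degSum S₀ + 2 * pairCount _≟ᵥ_ S₁ S₀
      ≡⟨ degSum-split S₁ S₀ ⟨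
    degSum (initialSegment (suc n) k) ∎
    where
    open ≤-Reasoning
    S₁ = initialSegment n ⌈ k /2⌉
    S₀ = initialSegment n ⌊ k /2⌋
    k₁≤ = ⌈k/2⌉≤2^n n k≤
    k₀≤ = ⌊k/2⌋≤2^n n k≤
    k₀≤c : ⌊ k /2⌋ ≤ pairCount _≟ᵥ_ S₁ S₀
    k₀≤c = begin
      ⌊ k /2⌋                 ≡⟨ length-initialSegment n k₀≤ ⟨
      length S₀               ≤⟨ ⊆⇒length≤pairCount _≟ᵥ_ (initialSegment-mono n (⌊n/2⌋≤⌈n/2⌉ k)) ⟩
      pairCount _≟ᵥ_ S₀ S₁    ≡⟨ pairCount-≡-sym _≟ᵥ_ S₀ S₁ ⟩
      pairCount _≟ᵥ_ S₁ S₀    ∎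

  ex-≤-harper : ∀ n k → ex n k ≤ harper n k
  ex-≤-harper n k = foldr-preservesᵇ {P = _≤ harper n k} ⊔-lub z≤n (All.map⁺ (All.tabulate bounded))
    where
    bounded : ∀ {X} → X ∈ subsetsOfSize n k → degSum X ≤ harper n k
    bounded X∈ with ∈-filter⁻ (λ X → length X ≟ k) X∈
    ... | X∈sublists , refl = degSum-≤-harper n (∈-sublists⁻ (vertices n) X∈sublists)

  ≤-foldr-⊔ : ∀ {x xs} → x ∈ xs → x ≤ foldr _⊔_ 0 xs
  ≤-foldr-⊔ {xs = y ∷ xs} (here refl) = m≤m⊔n y (foldr _⊔_ 0 xs)
  ≤-foldr-⊔ {xs = y ∷ xs} (there x∈)  = m≤n⇒m≤o⊔n y (≤-foldr-⊔ x∈)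

  harper-≤-ex : ∀ n {k} → k ≤ 2 ^ n → harper n k ≤ ex n k
  harper-≤-ex n {k} k≤ = ≤-trans (harper-≤-degSum n k≤) (≤-foldr-⊔ (∈-map⁺ degSum
    (∈-filter⁺ (λ X → length X ≟ k) (∈-sublists⁺ (initialSegment-⊆ n k)) (length-initialSegment n k≤))))

open Hypercube using (ex-≤-harper; harper-≤-ex)
open import Data.Fin using (Fin)
import Data.Fin as Fin
open import Data.Vec using (Vec; []; _∷_; sum; map; lookup)

sum-map-mono : ∀ {r} {f g : ℕ → ℕ} → (∀ k → f k ≤ g k) → (ms : Vec ℕ r) → sum (map f ms) ≤ sum (map g ms)
sum-map-mono f≤g []       = z≤n
sum-map-mono f≤g (m ∷ ms) = +-mono-≤ (f≤g m) (sum-map-mono f≤g ms)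

sum-map-suc : ∀ {r} (ks : Vec ℕ r) → sum (map suc ks) ≡ r + sum ks
sum-map-suc []       = refl
sum-map-suc {suc r} (k ∷ ks) = cong suc (trans (cong (k +_) (sum-map-suc ks)) (x∙yz≈y∙xz k r (sum ks)))

map-suc-pred : ∀ {r} (ms : Vec ℕ r) → (∀ i → 1 ≤ lookup ms i) → map suc (map pred ms) ≡ ms
map-suc-pred []       _   = refl
map-suc-pred (m ∷ ms) pos with pos Fin.zero
... | s≤s _ = cong (m ∷_) (map-suc-pred ms (pos ∘ Fin.suc))

harper-sum-suc : ∀ n {r} (ks : Vec ℕ r) → suc (sum ks) ≤ 2 ^ n →
  sum (map (harper n) (map suc ks)) ≤ harper n (suc (sum ks))
harper-sum-suc n []       _     = z≤n
harper-sum-suc n (k ∷ ks) bound = begin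
  harper n (suc k) + sum (map (harper n) (map suc ks))
    ≤⟨ +-monoʳ-≤ (harper n (suc k)) (harper-sum-suc n ks (≤-trans (s≤s (m≤n+m (sum ks) k)) bound)) ⟩
  harper n (suc k) + harper n (suc (sum ks))
    ≤⟨ harper-suc-superadditive n bound ⟩
  harper n (suc (k + sum ks)) ∎
  where open ≤-Reasoning

lemma11 : (n r : ℕ) → 1 ≤ n → 1 ≤ r → (ms : Vec ℕ r) →
    ((i : Fin r) → 1 ≤ lookup ms i) →
    sum ms ≤ 2 ^ n →
    sum (map (ex n) ms) ≤ ex n (sum ms ∸ r + 1)
lemma11 n r _ 1≤r ms pos sum≤ = begin
  sum (map (ex n) ms)                 ≤⟨ sum-map-mono (ex-≤-harper n) ms ⟩
  sum (map (harper n) ms)             ≡⟨ cong (sum ∘ map (harper n)) ms≡ ⟨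
  sum (map (harper n) (map suc ks))   ≤⟨ harper-sum-suc n ks bound ⟩
  harper n (suc (sum ks))             ≤⟨ harper-≤-ex n bound ⟩
  ex n (suc (sum ks))                 ≡⟨ cong (ex n) size ⟩
  ex n (sum ms ∸ r + 1)               ∎
  where
  open ≤-Reasoning
  ks = map pred ms
  ms≡ : map suc ks ≡ ms
  ms≡ = map-suc-pred ms pos
  sum≡ : sum ms ≡ r + sum ks
  sum≡ = trans (cong sum (sym ms≡)) (sum-map-suc ks)
  bound : suc (sum ks) ≤ 2 ^ n
  bound = ≤-trans (+-monoˡ-≤ (sum ks) 1≤r) (subst (_≤ 2 ^ n) sum≡ sum≤)
  size : suc (sum ks) ≡ sum ms ∸ r + 1
  size = sym (trans (cong (λ s → s ∸ r + 1) sum≡) (trans (cong (_+ 1) (m+n∸m≡n r (sum ks))) (+-comm (sum ks) 1)))
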